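{- For every positive integer $\ell$, the monotone consecutive patterns $\underline{12\cdots\ell}$ and $\underline{\ell(\ell-1)\cdots1}$ are stable.
   Context: For $(k_1,\ldots,k_n)\in\mathbb N^n$, $M(k_1,\ldots,k_n)$ denotes the multiset containing the letter $j$ exactly $k_j$ times; a permutation of $M$ is a word in which each letter $j$ occurs exactly $k_j$ times. An occurrence of $\underline{12\cdots\ell}$ (resp. $\underline{\ell\cdots1}$) in $\pi=\pi_1\cdots\pi_m$ is an index $a$ with $\pi_a<\pi_{a+1}<\cdots<\pi_{a+\ell-1}$ (resp. $\pi_a>\cdots>\pi_{a+\ell-1}$). $M^*(p;s)$ is the set of permutations of $M$ with exactly $s$ occurrences of $p$. A pattern $p$ is stable if for every $n$, every $(k_1,\ldots,k_n)\in\mathbb N^n$, every $\sigma\in\mathfrak S_n$ and every $s\in\mathbb N$, $|M(k_1,\ldots,k_n)^*(p;s)|=|M(k_{\sigma^{ -1}(1)},\ldots,k_{\sigma^{ -1}(n)})^*(p;s)|$. -}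

module Defs where

open import Data.Nat using (ℕ; zero; suc; _+_; _≡ᵇ_)
open import Data.Bool using (Bool; true; false; _∧_; if_then_else_)
open import Data.Fin using (Fin; _<?_; _≟_)
open import Data.Fin.Permutation using (Permutation′; _⟨$⟩ˡ_)
open import Data.List using (List; []; _∷_; length; take; filter)
open import Data.Vec using (Vec; tabulate; lookup)
open import Data.Product using (Σ; _×_)
open import Relation.Nullary using (does)
open import Relation.Binary.PropositionalEquality using (_≡_)
open import Function.Bundles using (_↔_)

-- Letters 1..n are represented by Fin n (0..n-1), with the same order.
-- Words (candidate permutations of a multiset) are lists of letters.

mult : ∀ {n} → Fin n → List (Fin n) → ℕ
mult j w = length (filter (_≟ j) w)

mults : ∀ {n} → List (Fin n) → Vec ℕ n
mults w = tabulate (λ j → mult j w)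

-- a "pattern" is given by its occurrence-counting function on words
Pattern : Set
Pattern = ∀ {n} → List (Fin n) → ℕ

incᵇ : ∀ {n} → List (Fin n) → Bool
incᵇ [] = true
incᵇ (x ∷ []) = true
incᵇ (x ∷ y ∷ r) = does (x <? y) ∧ incᵇ (y ∷ r)

decᵇ : ∀ {n} → List (Fin n) → Bool
decᵇ [] = true
decᵇ (x ∷ []) = true
decᵇ (x ∷ y ∷ r) = does (y <? x) ∧ decᵇ (y ∷ r)

chainOcc : (∀ {n} → List (Fin n) → Bool) → ℕ → Pattern
chainOcc t ℓ [] = 0
chainOcc t ℓ (x ∷ r) =
  (if (length (take ℓ (x ∷ r)) ≡ᵇ ℓ) ∧ t (take ℓ (x ∷ r)) then 1 else 0)
  + chainOcc t ℓ r

incPat : ℕ → Pattern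
incPat ℓ = chainOcc incᵇ ℓ

decPat : ℕ → Pattern
decPat ℓ = chainOcc decᵇ ℓ

MStar : ∀ {n} → Vec ℕ n → Pattern → ℕ → Set
MStar {n} k p s = Σ (List (Fin n)) (λ w → (mults w ≡ k) × (p w ≡ s))

permuteMult : ∀ {n} → Permutation′ n → Vec ℕ n → Vec ℕ n
permuteMult σ k = tabulate (λ j → lookup k (σ ⟨$⟩ˡ j))

-- stability: equal cardinalities of the (finite) sets, expressed as a bijection
Stable : Pattern → Set
Stable p = ∀ (n : ℕ) (k : Vec ℕ n) (σ : Permutation′ n) (s : ℕ) →
  MStar k p s ↔ MStar (permuteMult σ k) p s

-- Occurrences of a monotone consecutive pattern in a word depend only on the word's
-- length and on the comparisons between neighbouring letters.  Every rearrangement of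
-- the multiplicities is a product of adjacent transpositions, so it suffices to
-- exchange the multiplicities of two letters a < b with nothing in between by a
-- bijection that keeps all neighbour comparisons.  Cut each word at every letter
-- other than a, b and at every factor ab; the pieces in between have the shape bⁱaʲ,
-- and replacing each piece by bʲaⁱ does it: it is an involution exchanging the
-- numbers of a's and b's, a and b compare alike with every other letter, and no
-- piece bⁱaʲ contains an ascent.  For ℓ⋯1 the same construction runs with the roles
-- of a and b exchanged.

module Submission where

open import Axiom.UniquenessOfIdentityProofs using (module Decidable⇒UIP)
open import Data.Bool using (Bool; true; false; _∧_; if_then_else_)
open import Data.Empty using (⊥-elim; ⊥-elim-irr)
open import Data.Fin using (Fin; zero; suc; toℕ; _<?_; _≟_)
open import Data.Fin.Permutation using (Permutation′; _⟨$⟩ʳ_; lift₀-transpose) renaming (flip to inverse)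
open import Data.Fin.Permutation.Components using (transpose; transpose-inverse)
open import Data.Fin.Permutation.Transposition.List using (TranspositionList; eval; decompose; eval-decompose)
open import Data.Fin.Properties using (toℕ-injective)
open import Data.List using (List; []; _∷_; _++_; map; replicate; take; length)
open import Data.List.Properties using (map-∘; map-id; map-cong; map-++; map-replicate; ∷-injective)
open import Data.List.Relation.Binary.Permutation.Propositional
  using (_↭_; ↭-refl; prep; swap; module PermutationReasoning)
open import Data.List.Relation.Binary.Permutation.Propositional.Properties
  using (map⁺; shifts; ++⁺ˡ; filter-↭; ↭-length)
open import Data.Nat using (ℕ; zero; suc; _+_; _≥_; _≡ᵇ_)
import Data.Nat as ℕ
import Data.Nat.Properties as ℕ
open import Data.Product using (∃₂; _×_; _,_; proj₁; proj₂)
open import Data.Vec using (Vec; _∷_; tabulate; lookup)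
open import Data.Vec.Properties using (tabulate-cong; tabulate∘lookup; lookup∘tabulate; ≡-dec)
open import Function using (_∘_; _on_; flip; mk⇔)
open import Function.Bundles using (_↔_; mk↔ₛ′)
open import Function.Properties.Inverse using (↔-refl; ↔-trans)
open import Relation.Binary.Construct.Closure.ReflexiveTransitive
  using (Star; ε; _◅_; _◅◅_; gmap; reverse; fold)
open import Relation.Binary.Construct.Closure.ReflexiveTransitive.Properties using (module StarReasoning)
open import Relation.Binary.Definitions using (DecidableEquality)
open import Relation.Binary.PropositionalEquality
  using (_≡_; _≢_; _≗_; refl; sym; trans; cong; cong₂; subst; module ≡-Reasoning)
open import Relation.Nullary using (does; yes; no)
open import Relation.Nullary.Decidable using (does-⇔)

open import Defs

data AdjacentSwap {A : Set} : ∀ {n} → Vec A n → Vec A n → Set where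
  here  : ∀ {n x y} {xs : Vec A n} → AdjacentSwap (x ∷ y ∷ xs) (y ∷ x ∷ xs)
  there : ∀ {n x} {xs ys : Vec A n} → AdjacentSwap xs ys → AdjacentSwap (x ∷ xs) (x ∷ ys)

AdjacentSwaps : ∀ {A : Set} {n} → Vec A n → Vec A n → Set
AdjacentSwaps = Star AdjacentSwap

adjacentSwap-sym : ∀ {A : Set} {n} {xs ys : Vec A n} → AdjacentSwap xs ys → AdjacentSwap ys xs
adjacentSwap-sym here = here
adjacentSwap-sym (there s) = there (adjacentSwap-sym s)

transpose-conjugate : ∀ {n} (j : Fin n) (k : Fin (suc (suc n))) →
  transpose zero (suc zero) (transpose (suc zero) (suc (suc j)) (transpose zero (suc zero) k))
    ≡ transpose zero (suc (suc j)) k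
transpose-conjugate j zero = refl
transpose-conjugate j (suc zero) = refl
transpose-conjugate j (suc (suc k)) with does (k ≟ j)
... | true = refl
... | false = refl

module _ {A : Set} where

  swaps-∷ : ∀ {n} x {xs ys : Vec A n} → AdjacentSwaps xs ys → AdjacentSwaps (x ∷ xs) (x ∷ ys)
  swaps-∷ x = gmap (x ∷_) there

  transpose-zero-swaps : ∀ {n} (g : Fin (suc n) → A) (j : Fin n) →
    AdjacentSwaps (tabulate g) (tabulate (g ∘ transpose zero (suc j)))
  transpose-zero-swaps g zero = here ◅ ε
  transpose-zero-swaps {suc n} g (suc j) = begin
    tabulate g
      ⟶⟨ here ⟩
    tabulate h
      ⟶*⟨ swaps-∷ (h zero) (transpose-zero-swaps (h ∘ suc) j) ⟩
    h zero ∷ tabulate (h ∘ suc ∘ transpose zero (suc j))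
      ≡⟨ cong (h zero ∷_) (tabulate-cong λ k → cong h (sym (lift₀-transpose zero (suc j) (suc k)))) ⟩
    tabulate (h ∘ transpose (suc zero) (suc (suc j)))
      ⟶⟨ here ⟩
    tabulate (h ∘ transpose (suc zero) (suc (suc j)) ∘ transpose zero (suc zero))
      ≡⟨ tabulate-cong (cong g ∘ transpose-conjugate j) ⟩
    tabulate (g ∘ transpose zero (suc (suc j)))
      ∎
    where
    open StarReasoning AdjacentSwap
    h = g ∘ transpose zero (suc zero)

  transpose-swaps : ∀ {n} (g : Fin n → A) (i j : Fin n) →
    AdjacentSwaps (tabulate g) (tabulate (g ∘ transpose i j))
  transpose-swaps g zero zero = begin
    tabulate g                          ≡⟨ tabulate-cong {f = g} {g ∘ transpose zero zero} (λ { zero → refl ; (suc k) → refl }) ⟩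
    tabulate (g ∘ transpose zero zero)  ∎
    where open StarReasoning AdjacentSwap
  transpose-swaps g zero (suc j) = transpose-zero-swaps g j
  transpose-swaps g (suc i) zero = begin
    tabulate g                             ≡⟨ tabulate-cong (λ k → cong g (sym (transpose-inverse (suc i) zero {k}))) ⟩
    tabulate (h ∘ transpose zero (suc i))  ⟶*⟨ reverse adjacentSwap-sym (transpose-zero-swaps h i) ⟩
    tabulate h                             ∎
    where
    open StarReasoning AdjacentSwap
    h = g ∘ transpose (suc i) zero
  transpose-swaps g (suc i) (suc j) = begin
    g zero ∷ tabulate (g ∘ suc)                  ⟶*⟨ swaps-∷ (g zero) (transpose-swaps (g ∘ suc) i j) ⟩
    g zero ∷ tabulate (g ∘ suc ∘ transpose i j)  ≡⟨ cong (g zero ∷_) (tabulate-cong λ k → cong g (sym (lift₀-transpose i j (suc k)))) ⟩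
    tabulate (g ∘ transpose (suc i) (suc j))     ∎
    where open StarReasoning AdjacentSwap

  transpositions-swaps : ∀ {n} (g : Fin n → A) (ts : TranspositionList n) →
    AdjacentSwaps (tabulate g) (tabulate (g ∘ (eval ts ⟨$⟩ʳ_)))
  transpositions-swaps g [] = ε
  transpositions-swaps g ((i , j) ∷ ts) =
    transpositions-swaps g ts ◅◅ transpose-swaps (g ∘ (eval ts ⟨$⟩ʳ_)) i j

permuteMult-swaps : ∀ {n} (σ : Permutation′ n) (k : Vec ℕ n) → AdjacentSwaps k (permuteMult σ k)
permuteMult-swaps σ k = begin
  k                                               ≡⟨ tabulate∘lookup k ⟨
  tabulate (lookup k)                             ⟶*⟨ transpositions-swaps (lookup k) ts ⟩
  tabulate (lookup k ∘ (eval ts ⟨$⟩ʳ_))           ≡⟨ tabulate-cong (cong (lookup k) ∘ eval-decompose (inverse σ)) ⟩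
  permuteMult σ k                                 ∎
  where
  open StarReasoning AdjacentSwap
  ts = decompose (inverse σ)

record Exchanged {X V : Set} (a b : X) (f g : X → V) : Set where
  field
    at-a : g a ≡ f b
    at-b : g b ≡ f a
    elsewhere : ∀ j → j ≢ a → j ≢ b → g j ≡ f j

module _ {X V : Set} {a b : X} {f g : X → V} where

  Exchanged-sym : Exchanged a b f g → Exchanged a b g f
  Exchanged-sym e = record
    { at-a = sym at-b ; at-b = sym at-a ; elsewhere = λ j j≢a j≢b → sym (elsewhere j j≢a j≢b) }
    where open Exchanged e

  Exchanged-comm : Exchanged a b f g → Exchanged b a f g
  Exchanged-comm e = record { at-a = at-b ; at-b = at-a ; elsewhere = λ j j≢b j≢a → elsewhere j j≢a j≢b }
    where open Exchanged e

  Exchanged-cong : DecidableEquality X → ∀ {f' g'} → Exchanged a b f g → Exchanged a b f' g' → f ≗ f' → g ≗ g'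
  Exchanged-cong _≟ˣ_ e e' f≗f' j with j ≟ˣ a
  ... | yes refl = trans (Exchanged.at-a e) (trans (f≗f' b) (sym (Exchanged.at-a e')))
  ... | no j≢a with j ≟ˣ b
  ...   | yes refl = trans (Exchanged.at-b e) (trans (f≗f' a) (sym (Exchanged.at-b e')))
  ...   | no j≢b = trans (Exchanged.elsewhere e j j≢a j≢b) (trans (f≗f' j) (sym (Exchanged.elsewhere e' j j≢a j≢b)))

replicate-suc-++ : ∀ {A : Set} i (x : A) w → replicate (suc i) x ++ w ≡ replicate i x ++ x ∷ w
replicate-suc-++ zero x w = refl
replicate-suc-++ (suc i) x w = cong (x ∷_) (replicate-suc-++ i x w)

module _ {X : Set} (R : X → X → Bool) where

  links : X → List X → List Bool
  links x [] = []
  links x (y ∷ w) = R x y ∷ links y w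

  links-++ : ∀ {w w'} → (∀ z → links z w ≡ links z w') → ∀ x u → links x (u ++ w) ≡ links x (u ++ w')
  links-++ same x [] = same x
  links-++ same x (y ∷ u) = cong (R x y ∷_) (links-++ same y u)

  data Similar : List X → List X → Set where
    []  : Similar [] []
    [-] : ∀ {x x'} → Similar (x ∷ []) (x' ∷ [])
    _∷_ : ∀ {x y u x' y' u'} → R x y ≡ R x' y' → Similar (y ∷ u) (y' ∷ u') → Similar (x ∷ y ∷ u) (x' ∷ y' ∷ u')

  links⇒similar : ∀ x x' u u' → links x u ≡ links x' u' → Similar (x ∷ u) (x' ∷ u')
  links⇒similar x x' [] [] _ = [-]
  links⇒similar x x' (y ∷ u) (y' ∷ u') eq = proj₁ (∷-injective eq) ∷ links⇒similar y y' u u' (proj₂ (∷-injective eq))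

  links-from⇒similar : ∀ z u u' → links z u ≡ links z u' → Similar u u'
  links-from⇒similar z [] [] _ = []
  links-from⇒similar z (y ∷ u) (y' ∷ u') eq = links⇒similar y y' u u' (proj₂ (∷-injective eq))

links-map : ∀ {X Y : Set} (R : Y → Y → Bool) (f : X → Y) x w → links R (f x) (map f w) ≡ links (R on f) x w
links-map R f x [] = refl
links-map R f x (y ∷ w) = cong (R (f x) (f y) ∷_) (links-map R f y w)

-- R cannot tell a from b, except through the single comparison R a b.
record Twins {X : Set} (R : X → X → Bool) (a b : X) : Set where
  field
    distinct : a ≢ b
    left : ∀ x → x ≢ a → R x b ≡ R x a
    right : ∀ y → y ≢ b → R b y ≡ R a y

Twins-flip : ∀ {X} {R : X → X → Bool} {a b} → Twins R a b → Twins (flip R) b a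
Twins-flip t = record
  { distinct = distinct ∘ sym ; left = λ x x≢b → sym (right x x≢b) ; right = λ y y≢a → sym (left y y≢a) }
  where open Twins t

module BlockExchange {X : Set} (_≟_ : DecidableEquality X) {a b : X} (a≢b : a ≢ b) where

  -- The inequality proofs are irrelevant, so that classify (letter t) ≡ t holds on the nose.
  data Token : Set where
    A B : Token
    other : (y : X) → .(y ≢ a) → .(y ≢ b) → Token

  letter : Token → X
  letter A = a
  letter B = b
  letter (other y _ _) = y

  classify : X → Token
  classify x with x ≟ a
  ... | yes _ = A
  ... | no x≢a with x ≟ b
  ...   | yes _ = B
  ...   | no x≢b = other x x≢a x≢b

  letter-classify : ∀ x → letter (classify x) ≡ x
  letter-classify x with x ≟ a
  ... | yes x≡a = sym x≡a
  ... | no _ with x ≟ b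
  ...   | yes x≡b = sym x≡b
  ...   | no _ = refl

  classify-letter : ∀ t → classify (letter t) ≡ t
  classify-letter A with a ≟ a
  ... | yes _ = refl
  ... | no a≢a = ⊥-elim (a≢a refl)
  classify-letter B with b ≟ a
  ... | yes b≡a = ⊥-elim (a≢b (sym b≡a))
  ... | no _ with b ≟ b
  ...   | yes _ = refl
  ...   | no b≢b = ⊥-elim (b≢b refl)
  classify-letter (other y y≢a y≢b) with y ≟ a
  ... | yes y≡a = ⊥-elim-irr (y≢a y≡a)
  ... | no _ with y ≟ b
  ...   | yes y≡b = ⊥-elim-irr (y≢b y≡b)
  ...   | no _ = refl

  tokens : List X → List Token
  tokens = map classify

  letters : List Token → List X
  letters = map letter

  letters-tokens : ∀ w → letters (tokens w) ≡ w
  letters-tokens w = trans (sym (map-∘ w)) (trans (map-cong letter-classify w) (map-id w))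

  tokens-letters : ∀ u → tokens (letters u) ≡ u
  tokens-letters u = trans (sym (map-∘ u)) (trans (map-cong classify-letter u) (map-id u))

  swapToken : Token → Token
  swapToken A = B
  swapToken B = A
  swapToken t@(other _ _ _) = t

  swapToken-involutive : ∀ t → swapToken (swapToken t) ≡ t
  swapToken-involutive A = refl
  swapToken-involutive B = refl
  swapToken-involutive (other _ _ _) = refl

  swapLetter : X → X
  swapLetter = letter ∘ swapToken ∘ classify

  swapLetter-involutive : ∀ x → swapLetter (swapLetter x) ≡ x
  swapLetter-involutive x = begin
    letter (swapToken (classify (letter (swapToken t))))  ≡⟨ cong (letter ∘ swapToken) (classify-letter (swapToken t)) ⟩
    letter (swapToken (swapToken t))                      ≡⟨ cong letter (swapToken-involutive t) ⟩
    letter t                                              ≡⟨ letter-classify x ⟩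
    x                                                     ∎
    where
    open ≡-Reasoning
    t = classify x

  swapLetter-a : swapLetter a ≡ b
  swapLetter-a = cong (letter ∘ swapToken) (classify-letter A)

  swapLetter-b : swapLetter b ≡ a
  swapLetter-b = cong (letter ∘ swapToken) (classify-letter B)

  swapLetter-other : ∀ y → y ≢ a → y ≢ b → swapLetter y ≡ y
  swapLetter-other y y≢a y≢b = cong (letter ∘ swapToken) (classify-letter (other y y≢a y≢b))

  data Bar : Set where
    single : (y : X) → .(y ≢ a) → .(y ≢ b) → Bar
    ab : Bar

  bar : Bar → List Token
  bar (single y y≢a y≢b) = other y y≢a y≢b ∷ []
  bar ab = A ∷ B ∷ []

  data Blocks : Set where
    end : (i j : ℕ) → Blocks
    block : (i j : ℕ) → Bar → Blocks → Blocks

  run : ℕ → ℕ → List Token → List Token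
  run i j w = replicate i B ++ replicate j A ++ w

  render : Blocks → List Token
  render (end i j) = run i j []
  render (block i j β p) = run i j (bar β ++ render p)

  mirror : Blocks → Blocks
  mirror (end i j) = end j i
  mirror (block i j β p) = block j i β (mirror p)

  mirror-involutive : ∀ p → mirror (mirror p) ≡ p
  mirror-involutive (end i j) = refl
  mirror-involutive (block i j β p) = cong (block i j β) (mirror-involutive p)

  -- parseB i resumes after reading Bⁱ, parseA i j after reading Bⁱ Aʲ⁺¹.
  parseB : ℕ → List Token → Blocks
  parseA : ℕ → ℕ → List Token → Blocks

  parseB i [] = end i 0
  parseB i (A ∷ w) = parseA i 0 w
  parseB i (B ∷ w) = parseB (suc i) w
  parseB i (other y y≢a y≢b ∷ w) = block i 0 (single y y≢a y≢b) (parseB 0 w)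

  parseA i j [] = end i (suc j)
  parseA i j (A ∷ w) = parseA i (suc j) w
  parseA i j (B ∷ w) = block i j ab (parseB 0 w)
  parseA i j (other y y≢a y≢b ∷ w) = block i (suc j) (single y y≢a y≢b) (parseB 0 w)

  parse : List Token → Blocks
  parse = parseB 0

  resume : ℕ → ℕ → List Token → Blocks
  resume i zero w = parseB i w
  resume i (suc j) w = parseA i j w

  parseB-replicate : ∀ i k w → parseB i (replicate k B ++ w) ≡ parseB (i + k) w
  parseB-replicate i zero w = cong (λ m → parseB m w) (sym (ℕ.+-identityʳ i))
  parseB-replicate i (suc k) w = trans (parseB-replicate (suc i) k w) (cong (λ m → parseB m w) (sym (ℕ.+-suc i k)))

  parseA-replicate : ∀ i j k w → parseA i j (replicate k A ++ w) ≡ parseA i (j + k) w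
  parseA-replicate i j zero w = cong (λ m → parseA i m w) (sym (ℕ.+-identityʳ j))
  parseA-replicate i j (suc k) w = trans (parseA-replicate i (suc j) k w) (cong (λ m → parseA i m w) (sym (ℕ.+-suc j k)))

  parse-run : ∀ i j w → parse (run i j w) ≡ resume i j w
  parse-run i zero w = parseB-replicate 0 i w
  parse-run i (suc j) w = trans (parseB-replicate 0 i (A ∷ replicate j A ++ w)) (parseA-replicate i 0 j w)

  resume-bar : ∀ i j β w → resume i j (bar β ++ w) ≡ block i j β (parse w)
  resume-bar i zero (single _ _ _) w = refl
  resume-bar i zero ab w = refl
  resume-bar i (suc j) (single _ _ _) w = refl
  resume-bar i (suc j) ab w = refl

  parse-render : ∀ p → parse (render p) ≡ p
  parse-render (end i zero) = parse-run i 0 []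
  parse-render (end i (suc j)) = parse-run i (suc j) []
  parse-render (block i j β p) = begin
    parse (run i j (bar β ++ render p)) ≡⟨ parse-run i j _ ⟩
    resume i j (bar β ++ render p)      ≡⟨ resume-bar i j β _ ⟩
    block i j β (parse (render p))      ≡⟨ cong (block i j β) (parse-render p) ⟩
    block i j β p                       ∎
    where open ≡-Reasoning

  render-parseB : ∀ i w → render (parseB i w) ≡ replicate i B ++ w
  render-parseA : ∀ i j w → render (parseA i j w) ≡ run i j (A ∷ w)

  render-parseB i [] = refl
  render-parseB i (A ∷ w) = render-parseA i 0 w
  render-parseB i (B ∷ w) = trans (render-parseB (suc i) w) (replicate-suc-++ i B w)
  render-parseB i (t@(other _ _ _) ∷ w) = cong (λ u → run i 0 (t ∷ u)) (render-parseB 0 w)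

  render-parseA i j [] = cong (replicate i B ++_) (replicate-suc-++ j A [])
  render-parseA i j (A ∷ w) = trans (render-parseA i (suc j) w) (cong (replicate i B ++_) (replicate-suc-++ j A (A ∷ w)))
  render-parseA i j (B ∷ w) = cong (λ u → run i j (A ∷ B ∷ u)) (render-parseB 0 w)
  render-parseA i j (t@(other _ _ _) ∷ w) =
    trans (cong (λ u → run i (suc j) (t ∷ u)) (render-parseB 0 w)) (cong (replicate i B ++_) (replicate-suc-++ j A (t ∷ w)))

  render-parse : ∀ u → render (parse u) ≡ u
  render-parse = render-parseB 0

  exchange : List X → List X
  exchange w = letters (render (mirror (parse (tokens w))))

  exchange-involutive : ∀ w → exchange (exchange w) ≡ w
  exchange-involutive w = begin
    letters (render (mirror (parse (tokens (letters (render (mirror p)))))))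
      ≡⟨ cong (letters ∘ render ∘ mirror ∘ parse) (tokens-letters (render (mirror p))) ⟩
    letters (render (mirror (parse (render (mirror p)))))
      ≡⟨ cong (letters ∘ render ∘ mirror) (parse-render (mirror p)) ⟩
    letters (render (mirror (mirror p)))
      ≡⟨ cong (letters ∘ render) (mirror-involutive p) ⟩
    letters (render (parse (tokens w)))
      ≡⟨ cong letters (render-parse _) ⟩
    letters (tokens w)
      ≡⟨ letters-tokens w ⟩
    w ∎
    where
    open ≡-Reasoning
    p = parse (tokens w)

  map-swapToken-run : ∀ i j w → map swapToken (run i j w) ≡ replicate i A ++ replicate j B ++ map swapToken w
  map-swapToken-run i j w = begin
    map swapToken (replicate i B ++ replicate j A ++ w)
      ≡⟨ map-++ swapToken (replicate i B) _ ⟩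
    map swapToken (replicate i B) ++ map swapToken (replicate j A ++ w)
      ≡⟨ cong₂ _++_ (map-replicate swapToken i B) (map-++ swapToken (replicate j A) w) ⟩
    replicate i A ++ map swapToken (replicate j A) ++ map swapToken w
      ≡⟨ cong (λ u → replicate i A ++ u ++ map swapToken w) (map-replicate swapToken j A) ⟩
    replicate i A ++ replicate j B ++ map swapToken w
      ∎
    where open ≡-Reasoning

  run-↭ : ∀ i j {v w} → v ↭ map swapToken w → run j i v ↭ map swapToken (run i j w)
  run-↭ i j {v} {w} v↭w = begin
    replicate j B ++ replicate i A ++ v                ↭⟨ shifts (replicate j B) (replicate i A) ⟩
    replicate i A ++ replicate j B ++ v                ↭⟨ ++⁺ˡ (replicate i A) (++⁺ˡ (replicate j B) v↭w) ⟩
    replicate i A ++ replicate j B ++ map swapToken w  ≡⟨ map-swapToken-run i j w ⟨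
    map swapToken (run i j w)                          ∎
    where open PermutationReasoning

  bar-↭ : ∀ β {v w} → v ↭ map swapToken w → bar β ++ v ↭ map swapToken (bar β ++ w)
  bar-↭ (single y y≢a y≢b) v↭w = prep (other y y≢a y≢b) v↭w
  bar-↭ ab v↭w = swap A B v↭w

  render-mirror-↭ : ∀ p → render (mirror p) ↭ map swapToken (render p)
  render-mirror-↭ (end i j) = run-↭ i j ↭-refl
  render-mirror-↭ (block i j β p) = run-↭ i j (bar-↭ β (render-mirror-↭ p))

  exchange-↭ : ∀ w → exchange w ↭ map swapLetter w
  exchange-↭ w = begin
    letters (render (mirror (parse (tokens w))))     ↭⟨ map⁺ letter (render-mirror-↭ (parse (tokens w))) ⟩
    letters (map swapToken (render (parse (tokens w)))) ≡⟨ cong (letters ∘ map swapToken) (render-parse _) ⟩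
    letters (map swapToken (tokens w))               ≡⟨ sym (trans (map-∘ w) (cong letters (map-∘ w))) ⟩
    map swapLetter w                                 ∎
    where open PermutationReasoning

  module _ {R : X → X → Bool} (twins : Twins R a b) where

    open Twins twins using (left; right)

    private
      Rᵗ : Token → Token → Bool
      Rᵗ = R on letter

    links-B≡A-replicate : ∀ m {w} → links Rᵗ B w ≡ links Rᵗ A w →
      links Rᵗ B (replicate m A ++ w) ≡ links Rᵗ A (replicate m A ++ w)
    links-B≡A-replicate zero same = same
    links-B≡A-replicate (suc m) {w} same = cong (_∷ links Rᵗ A (replicate m A ++ w)) (right a a≢b)

    links-run : ∀ s i j {w} → Rᵗ s B ≡ Rᵗ s A → links Rᵗ B w ≡ links Rᵗ A w →
      links Rᵗ s (run i j w) ≡ links Rᵗ s (run 0 (i + j) w)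
    links-run s zero j _ _ = refl
    links-run s (suc i) j {w} sB≡sA same = begin
      Rᵗ s B ∷ links Rᵗ B (run i j w)                    ≡⟨ cong₂ _∷_ sB≡sA (links-run B i j (left b (a≢b ∘ sym)) same) ⟩
      Rᵗ s A ∷ links Rᵗ B (replicate (i + j) A ++ w)     ≡⟨ cong (_ ∷_) (links-B≡A-replicate (i + j) same) ⟩
      Rᵗ s A ∷ links Rᵗ A (replicate (i + j) A ++ w)     ∎
      where open ≡-Reasoning

    links-B≡A-bar : ∀ β w → links Rᵗ B (bar β ++ w) ≡ links Rᵗ A (bar β ++ w)
    links-B≡A-bar (single y y≢a y≢b) w =
      cong (_∷ links Rᵗ (other y y≢a y≢b) w) (right y (λ e → ⊥-elim-irr (y≢b e)))
    links-B≡A-bar ab w = cong (_∷ links Rᵗ A (B ∷ w)) (right a a≢b)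

    links-bar : ∀ β {w w'} → (∀ s → Rᵗ s B ≡ Rᵗ s A → links Rᵗ s w ≡ links Rᵗ s w') →
      ∀ z → links Rᵗ z (bar β ++ w) ≡ links Rᵗ z (bar β ++ w')
    links-bar (single y y≢a _) same z = cong (_ ∷_) (same (other y _ _) (left y (λ e → ⊥-elim-irr (y≢a e))))
    links-bar ab same z = cong (λ l → _ ∷ _ ∷ l) (same B (left b (a≢b ∘ sym)))

    links-render-mirror : ∀ p s → Rᵗ s B ≡ Rᵗ s A → links Rᵗ s (render p) ≡ links Rᵗ s (render (mirror p))
    links-render-mirror (end i j) s sB≡sA = begin
      links Rᵗ s (run i j [])               ≡⟨ links-run s i j sB≡sA refl ⟩
      links Rᵗ s (replicate (i + j) A ++ [])  ≡⟨ cong (λ m → links Rᵗ s (replicate m A ++ [])) (ℕ.+-comm i j) ⟩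
      links Rᵗ s (replicate (j + i) A ++ [])  ≡⟨ sym (links-run s j i sB≡sA refl) ⟩
      links Rᵗ s (run j i [])               ∎
      where open ≡-Reasoning
    links-render-mirror (block i j β p) s sB≡sA = begin
      links Rᵗ s (run i j (bar β ++ render p))                    ≡⟨ links-run s i j sB≡sA (links-B≡A-bar β _) ⟩
      links Rᵗ s (replicate (i + j) A ++ bar β ++ render p)        ≡⟨ cong (λ m → links Rᵗ s (replicate m A ++ bar β ++ render p)) (ℕ.+-comm i j) ⟩
      links Rᵗ s (replicate (j + i) A ++ bar β ++ render p)        ≡⟨ links-++ Rᵗ (links-bar β (links-render-mirror p)) s (replicate (j + i) A) ⟩
      links Rᵗ s (replicate (j + i) A ++ bar β ++ render (mirror p)) ≡⟨ sym (links-run s j i sB≡sA (links-B≡A-bar β _)) ⟩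
      links Rᵗ s (run j i (bar β ++ render (mirror p)))            ∎
      where open ≡-Reasoning

    -- The links from the extra first letter b are discarded; b is chosen because R b b ≡ R b a.
    exchange-similar : ∀ w → Similar R w (exchange w)
    exchange-similar w = links-from⇒similar R b w (exchange w) (begin
      links R b w                                         ≡⟨ cong (links R b) (sym (trans (cong letters (render-parse _)) (letters-tokens w))) ⟩
      links R (letter B) (letters (render p))             ≡⟨ links-map R letter B _ ⟩
      links Rᵗ B (render p)                               ≡⟨ links-render-mirror p B (left b (a≢b ∘ sym)) ⟩
      links Rᵗ B (render (mirror p))                      ≡⟨ sym (links-map R letter B _) ⟩
      links R b (exchange w)                              ∎)
      where
      open ≡-Reasoning
      p = parse (tokens w)

Adjacent : ∀ {n} → Fin n → Fin n → Set
Adjacent a b = toℕ b ≡ suc (toℕ a)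

_<ᵇ_ : ∀ {n} → Fin n → Fin n → Bool
x <ᵇ y = does (x <? y)

adjacent⇒twins : ∀ {n} {a b : Fin n} → Adjacent a b → Twins _<ᵇ_ a b
adjacent⇒twins {a = a} {b} b≡1+a = record
  { distinct = λ a≡b → ℕ.1+n≢n (trans (sym b≡1+a) (cong toℕ (sym a≡b)))
  ; left = λ x x≢a → does-⇔ (mk⇔ (below⇒below-a x≢a) below-a⇒below) (x <? b) (x <? a)
  ; right = λ y y≢b → does-⇔ (mk⇔ above⇒above-a (above-a⇒above y≢b)) (b <? y) (a <? y)
  }
  where
  below⇒below-a : ∀ {x} → x ≢ a → toℕ x ℕ.< toℕ b → toℕ x ℕ.< toℕ a
  below⇒below-a x≢a x<b = ℕ.≤∧≢⇒< (ℕ.≤-pred (subst (_ ℕ.<_) b≡1+a x<b)) (x≢a ∘ toℕ-injective)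
  below-a⇒below : ∀ {x} → toℕ x ℕ.< toℕ a → toℕ x ℕ.< toℕ b
  below-a⇒below x<a = subst (_ ℕ.<_) (sym b≡1+a) (ℕ.m<n⇒m<1+n x<a)
  above⇒above-a : ∀ {y} → toℕ b ℕ.< toℕ y → toℕ a ℕ.< toℕ y
  above⇒above-a b<y = ℕ.<-trans (subst (toℕ a ℕ.<_) (sym b≡1+a) (ℕ.n<1+n (toℕ a))) b<y
  above-a⇒above : ∀ {y} → y ≢ b → toℕ a ℕ.< toℕ y → toℕ b ℕ.< toℕ y
  above-a⇒above y≢b a<y = ℕ.≤∧≢⇒< (subst (ℕ._≤ _) (sym b≡1+a) a<y) (y≢b ∘ sym ∘ toℕ-injective)

module _ {n} {R : Fin n → Fin n → Bool} where

  similar-length : ∀ {u u'} → Similar R u u' → length u ≡ length u'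
  similar-length [] = refl
  similar-length [-] = refl
  similar-length (_ ∷ sim) = cong suc (similar-length sim)

  similar-take : ∀ ℓ {u u'} → Similar R u u' → Similar R (take ℓ u) (take ℓ u')
  similar-take zero _ = []
  similar-take (suc ℓ) [] = []
  similar-take (suc zero) [-] = [-]
  similar-take (suc (suc ℓ)) [-] = [-]
  similar-take (suc zero) (_ ∷ _) = [-]
  similar-take (suc (suc ℓ)) (xy ∷ sim) = xy ∷ similar-take (suc ℓ) sim

  similar-tail : ∀ {x x' u u'} → Similar R (x ∷ u) (x' ∷ u') → Similar R u u'
  similar-tail [-] = []
  similar-tail (_ ∷ sim) = sim

  chainOcc-similar : (t : ∀ {m} → List (Fin m) → Bool) → (∀ {u u'} → Similar R u u' → t u ≡ t u') →
    ∀ ℓ {w w'} → Similar R w w' → chainOcc t ℓ w ≡ chainOcc t ℓ w'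
  chainOcc-similar t t-similar ℓ [] = refl
  chainOcc-similar t t-similar ℓ {_ ∷ _} {_ ∷ _} sim = cong₂ _+_
    (cong₂ (λ m c → if (m ≡ᵇ ℓ) ∧ c then 1 else 0) (similar-length window) (t-similar window))
    (chainOcc-similar t t-similar ℓ (similar-tail sim))
    where window = similar-take ℓ sim

incᵇ-similar : ∀ {n} {u u' : List (Fin n)} → Similar _<ᵇ_ u u' → incᵇ u ≡ incᵇ u'
incᵇ-similar [] = refl
incᵇ-similar [-] = refl
incᵇ-similar (xy ∷ sim) = cong₂ _∧_ xy (incᵇ-similar sim)

decᵇ-similar : ∀ {n} {u u' : List (Fin n)} → Similar (flip _<ᵇ_) u u' → decᵇ u ≡ decᵇ u'
decᵇ-similar [] = refl
decᵇ-similar [-] = refl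
decᵇ-similar (xy ∷ sim) = cong₂ _∧_ xy (decᵇ-similar sim)

mult-↭ : ∀ {n} (j : Fin n) {u w} → u ↭ w → mult j u ≡ mult j w
mult-↭ j u↭w = ↭-length (filter-↭ (_≟ j) u↭w)

mult-map-involution : ∀ {n} (f : Fin n → Fin n) → (∀ x → f (f x) ≡ x) → ∀ j w → mult j (map f w) ≡ mult (f j) w
mult-map-involution f f-inv j [] = refl
mult-map-involution f f-inv j (x ∷ w) with f x ≟ j | x ≟ f j
... | yes _ | yes _ = cong suc (mult-map-involution f f-inv j w)
... | no _ | no _ = mult-map-involution f f-inv j w
... | yes fx≡j | no x≢fj = ⊥-elim (x≢fj (trans (sym (f-inv x)) (cong f fx≡j)))
... | no fx≢j | yes x≡fj = ⊥-elim (fx≢j (trans (cong f x≡fj) (f-inv j)))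

exchange-mults : ∀ {n} {a b : Fin n} (a≢b : a ≢ b) (w : List (Fin n)) →
  Exchanged a b (λ j → mult j w) (λ j → mult j (BlockExchange.exchange _≟_ a≢b w))
exchange-mults {a = a} {b} a≢b w = record
  { at-a = trans (mult-exchange a) (cong (λ j → mult j w) swapLetter-a)
  ; at-b = trans (mult-exchange b) (cong (λ j → mult j w) swapLetter-b)
  ; elsewhere = λ j j≢a j≢b → trans (mult-exchange j) (cong (λ j → mult j w) (swapLetter-other j j≢a j≢b))
  }
  where
  open BlockExchange _≟_ a≢b
  mult-exchange : ∀ j → mult j (exchange w) ≡ mult (swapLetter j) w
  mult-exchange j = trans (mult-↭ j (exchange-↭ w)) (mult-map-involution swapLetter swapLetter-involutive j w)

record Exchanger {n} (p : Pattern) (a b : Fin n) : Set where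
  field
    exchange : List (Fin n) → List (Fin n)
    involutive : ∀ w → exchange (exchange w) ≡ w
    exchanges-mults : ∀ w → Exchanged a b (λ j → mult j w) (λ j → mult j (exchange w))
    preserves : ∀ w → p (exchange w) ≡ p w

Exchanger-comm : ∀ {n} {p : Pattern} {a b : Fin n} → Exchanger p b a → Exchanger p a b
Exchanger-comm E = record
  { exchange = exchange ; involutive = involutive
  ; exchanges-mults = Exchanged-comm ∘ exchanges-mults ; preserves = preserves }
  where open Exchanger E

chainOcc-exchanger : ∀ {n} {R : Fin n → Fin n → Bool} {a b : Fin n} (t : ∀ {m} → List (Fin m) → Bool) →
  (∀ {u u'} → Similar R u u' → t u ≡ t u') → ∀ ℓ → Twins R a b → Exchanger (chainOcc t ℓ) a b
chainOcc-exchanger t t-similar ℓ twins = record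
  { exchange = exchange
  ; involutive = exchange-involutive
  ; exchanges-mults = exchange-mults distinct
  ; preserves = λ w → sym (chainOcc-similar t t-similar ℓ (exchange-similar twins w))
  }
  where
  open Twins twins
  open BlockExchange _≟_ distinct

MStar-≡ : ∀ {n} {k : Vec ℕ n} {p : Pattern} {s} {x y : MStar k p s} → proj₁ x ≡ proj₁ y → x ≡ y
MStar-≡ {x = w , m , o} {y = .w , m' , o'} refl =
  cong₂ (λ m o → w , m , o) (Decidable⇒UIP.≡-irrelevant (≡-dec ℕ._≟_) m m') (ℕ.≡-irrelevant o o')

module _ {n} {p : Pattern} {a b : Fin n} (E : Exchanger p a b) where
  open Exchanger E

  exchange-mults-≡ : ∀ {k k' : Vec ℕ n} → Exchanged a b (lookup k) (lookup k') →
    ∀ {w} → mults w ≡ k → mults (exchange w) ≡ k'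
  exchange-mults-≡ {k' = k'} k⇄k' {w} refl =
    trans (tabulate-cong (Exchanged-cong _≟_ (exchanges-mults w) k⇄k' (λ j → sym (lookup∘tabulate _ j)))) (tabulate∘lookup k')

  Exchanger-↔ : ∀ {k k'} → Exchanged a b (lookup k) (lookup k') → ∀ s → MStar k p s ↔ MStar k' p s
  Exchanger-↔ k⇄k' s = mk↔ₛ′ (move k⇄k') (move (Exchanged-sym k⇄k'))
    (λ _ → MStar-≡ {p = p} (involutive _)) (λ _ → MStar-≡ {p = p} (involutive _))
    where
    move : ∀ {k₁ k₂} → Exchanged a b (lookup k₁) (lookup k₂) → MStar k₁ p s → MStar k₂ p s
    move k₁⇄k₂ (w , m , o) = exchange w , exchange-mults-≡ k₁⇄k₂ m , trans (preserves w) o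

adjacentSwap-exchanged : ∀ {n} {k k' : Vec ℕ n} → AdjacentSwap k k' →
  ∃₂ λ a b → Adjacent a b × Exchanged a b (lookup k) (lookup k')
adjacentSwap-exchanged here = zero , suc zero , refl , record
  { at-a = refl ; at-b = refl
  ; elsewhere = λ { zero 0≢0 _ → ⊥-elim (0≢0 refl) ; (suc zero) _ 1≢1 → ⊥-elim (1≢1 refl) ; (suc (suc j)) _ _ → refl } }
adjacentSwap-exchanged (there sw) with adjacentSwap-exchanged sw
... | a , b , adj , e = suc a , suc b , cong suc adj , record
  { at-a = at-a ; at-b = at-b
  ; elsewhere = λ { zero _ _ → refl ; (suc j) j≢a j≢b → elsewhere j (j≢a ∘ cong suc) (j≢b ∘ cong suc) } }
  where open Exchanged e

stable-by-exchangers : ∀ {p : Pattern} → (∀ {n} {a b : Fin n} → Adjacent a b → Exchanger p a b) → Stable p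
stable-by-exchangers {p} E n k σ s =
  fold (λ k k' → MStar k p s ↔ MStar k' p s) (λ sw → ↔-trans (swap-↔ sw)) ↔-refl (permuteMult-swaps σ k)
  where
  swap-↔ : ∀ {k k'} → AdjacentSwap k k' → MStar k p s ↔ MStar k' p s
  swap-↔ sw with adjacentSwap-exchanged sw
  ... | _ , _ , adj , e = Exchanger-↔ (E adj) e s

theorem4p5 : (ℓ : ℕ) → ℓ ≥ 1 → Stable (incPat ℓ) × Stable (decPat ℓ)
-- The argument works for every ℓ.
theorem4p5 ℓ _ =
    stable-by-exchangers (λ adj → chainOcc-exchanger incᵇ incᵇ-similar ℓ (adjacent⇒twins adj))
  , stable-by-exchangers (λ adj →
      Exchanger-comm (chainOcc-exchanger decᵇ decᵇ-similar ℓ (Twins-flip (adjacent⇒twins adj))))
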